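{- Let $s,l,a,b,m$ be integers such that $s\geq l$ and $s\geq a\geq 0$. Then: (i) If $b>0$, then $\beta_{m}(s,l,a,b)=\beta_{m}(s+1,l,a,b)-\beta_{m}(s+1,l,a+1,b-1)$. (ii) If $a>0$ and $b\geq 0$, then $\beta_{m}(s,l,a-1,b)=\beta_{m}(s+1,l,a,b)-\beta_{m-1}(s+1,l,a-1,b+1)$. (iii) If $b\leq 0$, then $\beta_{m}(s,l,a,b)=\beta_{m}(s+1,l,a,b)-\beta_{m-1}(s+1,l,a+1,b-1)$. (iv) If $a>0$ and $b<0$, then $\beta_{m}(s,l,a-1,b)=\beta_{m}(s+1,l,a,b)-\beta_{m}(s+1,l,a-1,b+1)$.
   Context: Binomial coefficients: for an integer $n\geq 0$ and any integer $r$, $\binom{n}{r}=\frac{n!}{r!(n-r)!}$ if $0\leq r\leq n$ and $\binom{n}{r}=0$ otherwise. For an integer $b$ put $b_{+}=\frac{|b|+b}{2}$ and $b_{ - }=\frac{|b|-b}{2}$. For integers $a,b,s,l,m$ with $s\geq a\geq 0$ and $s\geq l$, define $$\beta_{m}(s,l,a,b)=\sum_{n=0}^{|b|+m}\binom{s-a}{b_{+}+m-n}\binom{a}{b_{ - }+m-n}\binom{s-l+n}{n},$$ where an empty sum (e.g. when $|b|+m<0$) is $0$. -}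

module Defs where

open import Data.Nat using (ℕ; zero; suc)
open import Data.Nat.Combinatorics using (_C_)
open import Data.Integer using (ℤ; +_; -[1+_]; _+_; _-_; -_; _⊔_; ∣_∣)
open import Data.Integer.Base using (0ℤ)

-- binomial coefficient (n choose r) for n ≥ 0 and any integer r;
-- it is 0 for r < 0 or r > n (the latter via stdlib's _C_).
-- For n < 0 (never used by the paper's β on its domain) it is set to 0.
binom : ℤ → ℤ → ℤ
binom (+ n) (+ r) = + (n C r)
binom (+ n) -[1+ r ] = 0ℤ
binom -[1+ n ] r = 0ℤ

-- b₊ = (|b|+b)/2 = max(b,0) ,  b₋ = (|b|-b)/2 = max(-b,0)
_₊ : ℤ → ℤ
b ₊ = b ⊔ 0ℤ

_₋ : ℤ → ℤ
b ₋ = (- b) ⊔ 0ℤ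

sumTo : ℕ → (ℕ → ℤ) → ℤ
sumTo zero f = f zero
sumTo (suc k) f = sumTo k f + f (suc k)

sumUpTo : ℤ → (ℕ → ℤ) → ℤ
sumUpTo (+ k) f = sumTo k f
sumUpTo -[1+ k ] f = 0ℤ

β : ℤ → ℤ → ℤ → ℤ → ℤ → ℤ
β m s l a b = sumUpTo (+ ∣ b ∣ + m) λ n →
  binom (s - a) ((b ₊) + m - + n) Data.Integer.*
  binom a ((b ₋) + m - + n) Data.Integer.*
  binom (s - l + + n) (+ n)

module Submission where

-- Write u(n) = C(P, X-n) C(A, Y-n) with P = s-a, A = a, X = b₊+m, Y = b₋+m,
-- and call Σ_{n ≤ M} u(n) C(t+n, n) a series (P, A, X, Y, t, M).
--  * Truncation: u(n) = 0 for n > X, so β is the series over ANY range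
--    M ≥ |b|+m; all β's of one recurrence are compared over a common M.
--  * Hockey stick + Abel summation: C(t+1+n, n) = Σ_{k ≤ n} C(t+k, k), hence
--    Σ u(n) C(t+n, n) = Σ (u(n) - u(n+1)) C(t+1+n, n) once u(M+1) = 0.
--  * Pascal for products: u(n) - u(n+1) = C(P,x)C(A,y) - C(P,x-1)C(A,y-1)
--    (x = X-n, y = Y-n) is also C(P+1,x)C(A,y) - C(P,x-1)C(A+1,y) and
--    C(P,x)C(A+1,y) - C(P+1,x)C(A,y-1).

open import Defs
open import Data.Integer using (ℤ; +_; _+_; _-_; _≤_; _<_; 0ℤ; 1ℤ)
open import Data.Product using (_×_)
open import Relation.Binary.PropositionalEquality using (_≡_)

open import Data.Nat as ℕ using (ℕ; zero; suc; _≤′_; ≤′-refl; ≤′-step)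
import Data.Nat.Properties as ℕP
open import Data.Nat.Combinatorics using (_C_; nCk+nC[k+1]≡[n+1]C[k+1])
open import Data.Integer using (-[1+_]; _*_; -_; ∣_∣; +≤+; -≤+; +<+; -<+)
import Data.Integer.Properties as ℤP
open import Data.Integer.Tactic.RingSolver using (solve-∀)
open import Data.Product using (_,_)
open import Relation.Binary.PropositionalEquality
  using (refl; sym; trans; cong; cong₂; subst; module ≡-Reasoning)
open ≡-Reasoning

pascal : ∀ n x → binom (+ suc n) x ≡ binom (+ n) x + binom (+ n) (x - 1ℤ)
pascal n (+ zero)  = refl
pascal n (+ suc k) =
  cong +_ (trans (sym (nCk+nC[k+1]≡[n+1]C[k+1] n k)) (ℕP.+-comm (n C k) (n C suc k)))
pascal n -[1+ k ]  = refl

binom-below : ∀ t {x y} → x < y → binom t (x - y) ≡ 0ℤ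
binom-below t {x} {y} x<y =
  vanish t (x - y) (subst (x - y <_) (ℤP.+-inverseʳ y) (ℤP.+-monoˡ-< (- y) x<y))
  where
  vanish : ∀ t z → z < 0ℤ → binom t z ≡ 0ℤ
  vanish (+ n)    -[1+ k ] _ = refl
  vanish -[1+ n ] z        _ = refl
  vanish (+ n)    (+ k)    (+<+ ())

pascal-productᴾ : ∀ P A x y →
  binom (+ suc P) x * binom (+ A) y - binom (+ P) (x - 1ℤ) * binom (+ suc A) y
    ≡ binom (+ P) x * binom (+ A) y - binom (+ P) (x - 1ℤ) * binom (+ A) (y - 1ℤ)
pascal-productᴾ P A x y
  rewrite pascal P x | pascal A y =
    expand (binom (+ P) x) (binom (+ P) (x - 1ℤ)) (binom (+ A) y) (binom (+ A) (y - 1ℤ))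
  where
  expand : ∀ c c′ d d′ → (c + c′) * d - c′ * (d + d′) ≡ c * d - c′ * d′
  expand = solve-∀

pascal-productᴬ : ∀ P A x y →
  binom (+ P) x * binom (+ suc A) y - binom (+ suc P) x * binom (+ A) (y - 1ℤ)
    ≡ binom (+ P) x * binom (+ A) y - binom (+ P) (x - 1ℤ) * binom (+ A) (y - 1ℤ)
pascal-productᴬ P A x y
  rewrite pascal P x | pascal A y =
    expand (binom (+ P) x) (binom (+ P) (x - 1ℤ)) (binom (+ A) y) (binom (+ A) (y - 1ℤ))
  where
  expand : ∀ c c′ d d′ → c * (d + d′) - (c + c′) * d′ ≡ c * d - c′ * d′
  expand = solve-∀

hockey-stick : ∀ T n → binom (+ suc T + + n) (+ n) ≡ sumTo n (λ k → binom (+ T + + k) (+ k))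
hockey-stick T zero    = refl
hockey-stick T (suc n) = begin
  binom (+ suc (T ℕ.+ suc n)) (+ suc n)
    ≡⟨ pascal (T ℕ.+ suc n) (+ suc n) ⟩
  binom (+ T + + suc n) (+ suc n) + binom (+ (T ℕ.+ suc n)) (+ n)
    ≡⟨ cong (λ r → binom (+ T + + suc n) (+ suc n) + binom (+ r) (+ n)) (ℕP.+-suc T n) ⟩
  binom (+ T + + suc n) (+ suc n) + binom (+ suc T + + n) (+ n)
    ≡⟨ cong (_+_ (binom (+ T + + suc n) (+ suc n))) (hockey-stick T n) ⟩
  binom (+ T + + suc n) (+ suc n) + sumTo n (λ k → binom (+ T + + k) (+ k))
    ≡⟨ ℤP.+-comm (binom (+ T + + suc n) (+ suc n)) (sumTo n (λ k → binom (+ T + + k) (+ k))) ⟩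
  sumTo (suc n) (λ k → binom (+ T + + k) (+ k)) ∎

sum-cong : ∀ M {f g : ℕ → ℤ} → (∀ n → f n ≡ g n) → sumTo M f ≡ sumTo M g
sum-cong zero    f≡g = f≡g zero
sum-cong (suc M) f≡g = cong₂ _+_ (sum-cong M f≡g) (f≡g (suc M))

sum-sub : ∀ M (f g : ℕ → ℤ) → sumTo M (λ n → f n - g n) ≡ sumTo M f - sumTo M g
sum-sub zero    f g = refl
sum-sub (suc M) f g = begin
  sumTo M (λ n → f n - g n) + (f (suc M) - g (suc M))
    ≡⟨ cong (_+ (f (suc M) - g (suc M))) (sum-sub M f g) ⟩
  (sumTo M f - sumTo M g) + (f (suc M) - g (suc M))
    ≡⟨ regroup (sumTo M f) (f (suc M)) (sumTo M g) (g (suc M)) ⟩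
  (sumTo M f + f (suc M)) - (sumTo M g + g (suc M)) ∎
  where
  regroup : ∀ a b c d → (a - c) + (b - d) ≡ (a + b) - (c + d)
  regroup = solve-∀

sum-extend : ∀ {k M} (f : ℕ → ℤ) → k ≤′ M → (∀ n → k ℕ.< n → f n ≡ 0ℤ) → sumTo M f ≡ sumTo k f
sum-extend f ≤′-refl             _      = refl
sum-extend {k} f (≤′-step {M} k≤′M) beyond = begin
  sumTo M f + f (suc M)
    ≡⟨ cong₂ _+_ (sum-extend f k≤′M beyond) (beyond (suc M) (ℕ.s≤s (ℕP.≤′⇒≤ k≤′M))) ⟩
  sumTo k f + 0ℤ
    ≡⟨ ℤP.+-identityʳ (sumTo k f) ⟩
  sumTo k f ∎

sum-truncate : ∀ E M (f : ℕ → ℤ) → E ≤ + M → (∀ n → E < + n → f n ≡ 0ℤ) → sumUpTo E f ≡ sumTo M f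
sum-truncate (+ k)    M f (+≤+ k≤M) beyond =
  sym (sum-extend f (ℕP.≤⇒≤′ k≤M) (λ n k<n → beyond n (+<+ k<n)))
sum-truncate -[1+ k ] M f _         beyond =
  sym (trans (sum-extend {M = M} f (ℕP.≤⇒≤′ ℕ.z≤n) (λ n _ → beyond n -<+)) (beyond 0 -<+))

distribʳ-minus : ∀ x y z → (x - y) * z ≡ x * z - y * z
distribʳ-minus = solve-∀

abel : ∀ (u v : ℕ → ℤ) M →
  sumTo M (λ n → (u n - u (suc n)) * sumTo n v) ≡ sumTo M (λ n → u n * v n) - u (suc M) * sumTo M v
abel u v zero    = distribʳ-minus (u 0) (u 1) (v 0)
abel u v (suc M) = begin
  sumTo M (λ n → (u n - u (suc n)) * sumTo n v) + (u (suc M) - u (suc (suc M))) * sumTo (suc M) v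
    ≡⟨ cong (_+ (u (suc M) - u (suc (suc M))) * sumTo (suc M) v) (abel u v M) ⟩
  (sumTo M (λ n → u n * v n) - u (suc M) * sumTo M v) + (u (suc M) - u (suc (suc M))) * (sumTo M v + v (suc M))
    ≡⟨ step (sumTo M (λ n → u n * v n)) (sumTo M v) (u (suc M)) (u (suc (suc M))) (v (suc M)) ⟩
  sumTo (suc M) (λ n → u n * v n) - u (suc (suc M)) * sumTo (suc M) v ∎
  where
  step : ∀ S W u₁ u₂ v₁ → (S - u₁ * W) + (u₁ - u₂) * (W + v₁) ≡ (S + u₁ * v₁) - u₂ * (W + v₁)
  step = solve-∀

telescope : ∀ (u f g v : ℕ → ℤ) M → (∀ n → f n - g n ≡ u n - u (suc n)) → u (suc M) ≡ 0ℤ →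
  sumTo M (λ n → u n * v n) ≡ sumTo M (λ n → f n * sumTo n v) - sumTo M (λ n → g n * sumTo n v)
telescope u f g v M difference u-end = begin
  sumTo M (λ n → u n * v n)
    ≡⟨ sym (trans (cong (λ x → sumTo M (λ n → u n * v n) - x * sumTo M v) u-end) (ℤP.+-identityʳ _)) ⟩
  sumTo M (λ n → u n * v n) - u (suc M) * sumTo M v
    ≡⟨ sym (abel u v M) ⟩
  sumTo M (λ n → (u n - u (suc n)) * sumTo n v)
    ≡⟨ sum-cong M (λ n → trans (cong (_* sumTo n v) (sym (difference n))) (distribʳ-minus (f n) (g n) (sumTo n v))) ⟩
  sumTo M (λ n → f n * sumTo n v - g n * sumTo n v)
    ≡⟨ sum-sub M (λ n → f n * sumTo n v) (λ n → g n * sumTo n v) ⟩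
  sumTo M (λ n → f n * sumTo n v) - sumTo M (λ n → g n * sumTo n v) ∎

term : ℤ → ℤ → ℤ → ℤ → ℕ → ℤ
term P A X Y n = binom P (X - + n) * binom A (Y - + n)

series : ℤ → ℤ → ℤ → ℤ → ℤ → ℕ → ℤ
series P A X Y t M = sumTo M λ n → term P A X Y n * binom (t + + n) (+ n)

term-beyond : ∀ P A X Y n → X < + n → term P A X Y n ≡ 0ℤ
term-beyond P A X Y n X<n
  rewrite binom-below P X<n = ℤP.*-zeroˡ (binom A (Y - + n))

minus-suc : ∀ Z n → Z - + suc n ≡ Z - + n - 1ℤ
minus-suc Z n = shift Z (+ n)
  where
  shift : ∀ Z N → Z - (1ℤ + N) ≡ Z - N - 1ℤ
  shift = solve-∀

minus-pred : ∀ Z n → Z - 1ℤ - + n ≡ Z - + n - 1ℤ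
minus-pred Z n = swap Z (+ n)
  where
  swap : ∀ Z N → Z - 1ℤ - N ≡ Z - N - 1ℤ
  swap = solve-∀

difference-ᴾ : ∀ P A X Y n →
  term (+ suc P) (+ A) X Y n - term (+ P) (+ suc A) (X - 1ℤ) Y n
    ≡ term (+ P) (+ A) X Y n - term (+ P) (+ A) X Y (suc n)
difference-ᴾ P A X Y n
  rewrite minus-pred X n | minus-suc X n | minus-suc Y n = pascal-productᴾ P A (X - + n) (Y - + n)

difference-ᴬ : ∀ P A X Y n →
  term (+ P) (+ suc A) X Y n - term (+ suc P) (+ A) X (Y - 1ℤ) n
    ≡ term (+ P) (+ A) X Y n - term (+ P) (+ A) X Y (suc n)
difference-ᴬ P A X Y n
  rewrite minus-pred Y n | minus-suc X n | minus-suc Y n = pascal-productᴬ P A (X - + n) (Y - + n)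

series-raise : ∀ P A X Y T M →
  series P A X Y (+ suc T) M ≡ sumTo M (λ n → term P A X Y n * sumTo n (λ k → binom (+ T + + k) (+ k)))
series-raise P A X Y T M = sum-cong M (λ n → cong (term P A X Y n *_) (hockey-stick T n))

series-step : ∀ {P A X Y P₁ A₁ X₁ Y₁ P₂ A₂ X₂ Y₂} T M → X ≤ + M →
  (∀ n → term P₁ A₁ X₁ Y₁ n - term P₂ A₂ X₂ Y₂ n ≡ term P A X Y n - term P A X Y (suc n)) →
  series P A X Y (+ T) M ≡ series P₁ A₁ X₁ Y₁ (+ suc T) M - series P₂ A₂ X₂ Y₂ (+ suc T) M
series-step {P} {A} {X} {Y} {P₁} {A₁} {X₁} {Y₁} {P₂} {A₂} {X₂} {Y₂} T M X≤M difference = begin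
  series P A X Y (+ T) M
    ≡⟨ telescope (term P A X Y) (term P₁ A₁ X₁ Y₁) (term P₂ A₂ X₂ Y₂) v M difference
         (term-beyond P A X Y (suc M) (ℤP.≤-<-trans X≤M (+<+ (ℕP.n<1+n M)))) ⟩
  sumTo M (λ n → term P₁ A₁ X₁ Y₁ n * sumTo n v) - sumTo M (λ n → term P₂ A₂ X₂ Y₂ n * sumTo n v)
    ≡⟨ sym (cong₂ _-_ (series-raise P₁ A₁ X₁ Y₁ T M) (series-raise P₂ A₂ X₂ Y₂ T M)) ⟩
  series P₁ A₁ X₁ Y₁ (+ suc T) M - series P₂ A₂ X₂ Y₂ (+ suc T) M ∎
  where
  v : ℕ → ℤ
  v k = binom (+ T + + k) (+ k)

series-stepᴾ : ∀ P A X Y T M → X ≤ + M →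
  series (+ P) (+ A) X Y (+ T) M
    ≡ series (+ suc P) (+ A) X Y (+ suc T) M - series (+ P) (+ suc A) (X - 1ℤ) Y (+ suc T) M
series-stepᴾ P A X Y T M X≤M =
  series-step {+ P} {+ A} {X} {Y} {+ suc P} {+ A} {X} {Y} {+ P} {+ suc A} {X - 1ℤ} {Y}
    T M X≤M (difference-ᴾ P A X Y)

series-stepᴬ : ∀ P A X Y T M → X ≤ + M →
  series (+ P) (+ A) X Y (+ T) M
    ≡ series (+ P) (+ suc A) X Y (+ suc T) M - series (+ suc P) (+ A) X (Y - 1ℤ) (+ suc T) M
series-stepᴬ P A X Y T M X≤M =
  series-step {+ P} {+ A} {X} {Y} {+ P} {+ suc A} {X} {Y} {+ suc P} {+ A} {X} {Y - 1ℤ}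
    T M X≤M (difference-ᴬ P A X Y)

₊≤∣∣ : ∀ b → b ₊ ≤ + ∣ b ∣
₊≤∣∣ (+ k)    = +≤+ (ℕP.⊔-lub ℕP.≤-refl ℕ.z≤n)
₊≤∣∣ -[1+ k ] = +≤+ ℕ.z≤n

-- β is the series with P = s-a, A = a, X = b₊+m, Y = b₋+m, t = s-l over any
-- range M ≥ |b| + m; the parameters may be given in any equal form.
β≡series : ∀ m s l a b {P A X Y t} M → + ∣ b ∣ + m ≤ + M →
  s - a ≡ P → a ≡ A → b ₊ + m ≡ X → b ₋ + m ≡ Y → s - l ≡ t → β m s l a b ≡ series P A X Y t M
β≡series m s l a b M in-range refl refl refl refl refl =
  sum-truncate (+ ∣ b ∣ + m) M _ in-range vanish
  where
  vanish : ∀ n → + ∣ b ∣ + m < + n →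
    term (s - a) a (b ₊ + m) (b ₋ + m) n * binom (s - l + + n) (+ n) ≡ 0ℤ
  vanish n beyond = trans
    (cong (_* binom (s - l + + n) (+ n))
      (term-beyond (s - a) a (b ₊ + m) (b ₋ + m) n (ℤP.≤-<-trans (ℤP.+-monoˡ-≤ m (₊≤∣∣ b)) beyond)))
    (ℤP.*-zeroˡ (binom (s - l + + n) (+ n)))

₊-nonneg : ∀ {b} → 0ℤ ≤ b → b ₊ ≡ b
₊-nonneg = ℤP.i≥j⇒i⊔j≡i

₋-nonneg : ∀ {b} → 0ℤ ≤ b → b ₋ ≡ 0ℤ
₋-nonneg 0≤b = ℤP.i≤j⇒i⊔j≡j (ℤP.neg-mono-≤ 0≤b)

₊-nonpos : ∀ {b} → b ≤ 0ℤ → b ₊ ≡ 0ℤ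
₊-nonpos = ℤP.i≤j⇒i⊔j≡j

₋-nonpos : ∀ {b} → b ≤ 0ℤ → b ₋ ≡ - b
₋-nonpos b≤0 = ℤP.i≥j⇒i⊔j≡i (ℤP.neg-mono-≤ b≤0)

predˡ : ∀ K m → K + m ≡ (1ℤ + K) + m - 1ℤ
predˡ = solve-∀

predʳ : ∀ m → 0ℤ + (m - 1ℤ) ≡ 0ℤ + m - 1ℤ
predʳ = solve-∀

indices-i : ∀ b m → 0ℤ < b → ((b - 1ℤ) ₊ + m ≡ b ₊ + m - 1ℤ) × ((b - 1ℤ) ₋ + m ≡ b ₋ + m)
indices-i (+ zero)  m (+<+ ())
indices-i (+ suc k) m _
  rewrite ₊-nonneg (+≤+ (ℕ.z≤n {k})) | ₋-nonneg (+≤+ (ℕ.z≤n {k})) = predˡ (+ k) m , refl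

indices-iii : ∀ b m → b ≤ 0ℤ →
  ((b - 1ℤ) ₊ + (m - 1ℤ) ≡ b ₊ + m - 1ℤ) × ((b - 1ℤ) ₋ + (m - 1ℤ) ≡ b ₋ + m)
indices-iii b m b≤0
  rewrite ₊-nonpos b≤0 | ₋-nonpos b≤0
        | ₊-nonpos (ℤP.i≤j⇒i-k≤j 1ℤ b≤0) | ₋-nonpos (ℤP.i≤j⇒i-k≤j 1ℤ b≤0) = predʳ m , shift b m
  where
  shift : ∀ b m → - (b - 1ℤ) + (m - 1ℤ) ≡ - b + m
  shift = solve-∀

indices-ii : ∀ b m → 0ℤ ≤ b →
  ((b + 1ℤ) ₊ + (m - 1ℤ) ≡ b ₊ + m) × ((b + 1ℤ) ₋ + (m - 1ℤ) ≡ b ₋ + m - 1ℤ)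
indices-ii b m 0≤b
  rewrite ₊-nonneg 0≤b | ₋-nonneg 0≤b
        | ₊-nonneg (ℤP.≤-trans 0≤b (ℤP.i≤i+j b 1ℤ)) | ₋-nonneg (ℤP.≤-trans 0≤b (ℤP.i≤i+j b 1ℤ)) =
    shift b m , predʳ m
  where
  shift : ∀ b m → b + 1ℤ + (m - 1ℤ) ≡ b + m
  shift = solve-∀

indices-iv : ∀ b m → b < 0ℤ → ((b + 1ℤ) ₊ + m ≡ b ₊ + m) × ((b + 1ℤ) ₋ + m ≡ b ₋ + m - 1ℤ)
indices-iv (+ n)         m (+<+ ())
indices-iv -[1+ zero ]  m _ = refl , predˡ 0ℤ m
indices-iv -[1+ suc k ] m _ = refl , predˡ (+ suc k) m

-- A common summation range for all β's of one recurrence: each has |b'| ≤ |b| + 1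
-- and m' ≤ m, hence range |b'| + m' ≤ |b| + 1 + |m|.
range : ℤ → ℤ → ℕ
range b m = ∣ b ∣ ℕ.+ 1 ℕ.+ ∣ m ∣

within : ∀ b m {k m′} → k ℕ.≤ ∣ b ∣ ℕ.+ 1 → m′ ≤ m → + k + m′ ≤ + range b m
within b m k≤ m′≤m =
  ℤP.≤-trans (ℤP.+-mono-≤ (+≤+ k≤) m′≤m) (ℤP.+-monoʳ-≤ (+ (∣ b ∣ ℕ.+ 1)) (≤∣∣ m))
  where
  ≤∣∣ : ∀ m → m ≤ + ∣ m ∣
  ≤∣∣ (+ k)    = ℤP.≤-refl
  ≤∣∣ -[1+ k ] = -≤+

within-itself : ∀ b m → + ∣ b ∣ + m ≤ + range b m
within-itself b m = within b m (ℕP.m≤m+n ∣ b ∣ 1) ℤP.≤-refl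

-- The upper index X = b₊ + m stays within the range (needed for u(M+1) = 0).
X-within : ∀ b m → b ₊ + m ≤ + range b m
X-within b m = ℤP.≤-trans (ℤP.+-monoˡ-≤ m (₊≤∣∣ b)) (within-itself b m)

as-ℕ : ∀ {z} → 0ℤ ≤ z → z ≡ + ∣ z ∣
as-ℕ 0≤z = sym (ℤP.0≤i⇒+∣i∣≡i 0≤z)

succ-of : ∀ {z N} → z ≡ + N → z + 1ℤ ≡ + suc N
succ-of {N = N} refl = cong +_ (ℕP.+-comm N 1)

difference-ℕ : ∀ {x s} → x ≤ s → s - x ≡ + ∣ s - x ∣
difference-ℕ x≤s = as-ℕ (ℤP.i≤j⇒0≤j-i x≤s)

raise-left : ∀ s x → s + 1ℤ - x ≡ (s - x) + 1ℤ
raise-left = solve-∀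

raised-ℕ : ∀ s x → x ≤ s → s + 1ℤ - x ≡ + suc ∣ s - x ∣
raised-ℕ s x x≤s = trans (raise-left s x) (succ-of (difference-ℕ x≤s))

pred-nonneg : ∀ {a} → 0ℤ < a → 0ℤ ≤ a - 1ℤ
pred-nonneg {+ zero}  (+<+ ())
pred-nonneg {+ suc k} _ = +≤+ ℕ.z≤n

recurrence : ∀ {L A B sL sA sB : ℤ} → L ≡ sL → A ≡ sA → B ≡ sB → sL ≡ sA - sB → L ≡ A - B
recurrence refl refl refl identity = identity

recurrence-a+1 : ∀ s l a b m b′ m′ → l ≤ s → 0ℤ ≤ a → a ≤ s →
  ∣ b′ ∣ ℕ.≤ ∣ b ∣ ℕ.+ 1 → m′ ≤ m → (b′ ₊ + m′ ≡ b ₊ + m - 1ℤ) × (b′ ₋ + m′ ≡ b ₋ + m) →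
  β m s l a b ≡ β m (s + 1ℤ) l a b - β m′ (s + 1ℤ) l (a + 1ℤ) b′
recurrence-a+1 s l a b m b′ m′ l≤s 0≤a a≤s ∣b′∣≤ m′≤m (X′ , Y′) = recurrence
  (β≡series m s l a b M (within-itself b m) (difference-ℕ a≤s) (as-ℕ 0≤a) refl refl (difference-ℕ l≤s))
  (β≡series m (s + 1ℤ) l a b M (within-itself b m) (raised-ℕ s a a≤s) (as-ℕ 0≤a) refl refl (raised-ℕ s l l≤s))
  (β≡series m′ (s + 1ℤ) l (a + 1ℤ) b′ M (within b m ∣b′∣≤ m′≤m)
    (trans (raise-both s a) (difference-ℕ a≤s)) (succ-of (as-ℕ 0≤a)) X′ Y′ (raised-ℕ s l l≤s))
  (series-stepᴾ (∣ s - a ∣) (∣ a ∣) (b ₊ + m) (b ₋ + m) (∣ s - l ∣) M (X-within b m))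
  where
  M : ℕ
  M = range b m
  raise-both : ∀ s a → s + 1ℤ - (a + 1ℤ) ≡ s - a
  raise-both = solve-∀

recurrence-a-1 : ∀ s l a b m b′ m′ → l ≤ s → 0ℤ < a → a ≤ s →
  ∣ b′ ∣ ℕ.≤ ∣ b ∣ ℕ.+ 1 → m′ ≤ m → (b′ ₊ + m′ ≡ b ₊ + m) × (b′ ₋ + m′ ≡ b ₋ + m - 1ℤ) →
  β m s l (a - 1ℤ) b ≡ β m (s + 1ℤ) l a b - β m′ (s + 1ℤ) l (a - 1ℤ) b′
recurrence-a-1 s l a b m b′ m′ l≤s 0<a a≤s ∣b′∣≤ m′≤m (X′ , Y′) = recurrence
  (β≡series m s l (a - 1ℤ) b M (within-itself b m) s-[a-1]≡P+1 a-1≡A refl refl (difference-ℕ l≤s))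
  (β≡series m (s + 1ℤ) l a b M (within-itself b m) (raised-ℕ s a a≤s)
    (trans (pred-succ a) (succ-of a-1≡A)) refl refl (raised-ℕ s l l≤s))
  (β≡series m′ (s + 1ℤ) l (a - 1ℤ) b′ M (within b m ∣b′∣≤ m′≤m)
    (trans (raise-left s (a - 1ℤ)) (succ-of s-[a-1]≡P+1)) a-1≡A X′ Y′ (raised-ℕ s l l≤s))
  (series-stepᴬ (suc ∣ s - a ∣) (∣ a - 1ℤ ∣) (b ₊ + m) (b ₋ + m) (∣ s - l ∣) M (X-within b m))
  where
  M : ℕ
  M = range b m
  a-1≡A : a - 1ℤ ≡ + ∣ a - 1ℤ ∣
  a-1≡A = as-ℕ (pred-nonneg 0<a)
  s-[a-1]≡P+1 : s - (a - 1ℤ) ≡ + suc ∣ s - a ∣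
  s-[a-1]≡P+1 = trans (lower-right s a) (succ-of (difference-ℕ a≤s))
    where
    lower-right : ∀ s a → s - (a - 1ℤ) ≡ (s - a) + 1ℤ
    lower-right = solve-∀
  pred-succ : ∀ a → a ≡ (a - 1ℤ) + 1ℤ
  pred-succ = solve-∀

lemma2p1 : (s l a b m : ℤ) → l ≤ s → 0ℤ ≤ a → a ≤ s →
    ((0ℤ < b → β m s l a b ≡ β m (s + 1ℤ) l a b - β m (s + 1ℤ) l (a + 1ℤ) (b - 1ℤ))
    × (0ℤ < a → 0ℤ ≤ b → β m s l (a - 1ℤ) b ≡ β m (s + 1ℤ) l a b - β (m - 1ℤ) (s + 1ℤ) l (a - 1ℤ) (b + 1ℤ))
    × (b ≤ 0ℤ → β m s l a b ≡ β m (s + 1ℤ) l a b - β (m - 1ℤ) (s + 1ℤ) l (a + 1ℤ) (b - 1ℤ))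
    × (0ℤ < a → b < 0ℤ → β m s l (a - 1ℤ) b ≡ β m (s + 1ℤ) l a b - β m (s + 1ℤ) l (a - 1ℤ) (b + 1ℤ)))
lemma2p1 s l a b m l≤s 0≤a a≤s =
    (λ 0<b → recurrence-a+1 s l a b m (b - 1ℤ) m l≤s 0≤a a≤s ∣b-1∣≤ ℤP.≤-refl (indices-i b m 0<b))
  , (λ 0<a 0≤b → recurrence-a-1 s l a b m (b + 1ℤ) (m - 1ℤ) l≤s 0<a a≤s ∣b+1∣≤ m-1≤m (indices-ii b m 0≤b))
  , (λ b≤0 → recurrence-a+1 s l a b m (b - 1ℤ) (m - 1ℤ) l≤s 0≤a a≤s ∣b-1∣≤ m-1≤m (indices-iii b m b≤0))
  , (λ 0<a b<0 → recurrence-a-1 s l a b m (b + 1ℤ) m l≤s 0<a a≤s ∣b+1∣≤ ℤP.≤-refl (indices-iv b m b<0))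
  where
  ∣b-1∣≤ : ∣ b - 1ℤ ∣ ℕ.≤ ∣ b ∣ ℕ.+ 1
  ∣b-1∣≤ = ℤP.∣i+j∣≤∣i∣+∣j∣ b (- 1ℤ)
  ∣b+1∣≤ : ∣ b + 1ℤ ∣ ℕ.≤ ∣ b ∣ ℕ.+ 1
  ∣b+1∣≤ = ℤP.∣i+j∣≤∣i∣+∣j∣ b 1ℤ
  m-1≤m : m - 1ℤ ≤ m
  m-1≤m = ℤP.i≤j⇒i-k≤j 1ℤ ℤP.≤-refl
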